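{- Let $(V,E)$ be a hypergraph with $V=[n]$ in which every hyperedge has size at most $d$, and suppose an unknown hyperedge $e^*\in E$ is defective. For any positive integer $p\le d-1$, there exists a non-adaptive group testing algorithm using $t=O\left(\frac{d}{p}\log|E|\right)$ tests which discards all hyperedges except those $e\in E$ with $|e\setminus e^*|<p$ (the defective hyperedge $e^*$ itself is never discarded).
   Context: Group testing on a hypergraph $(V,E)$ with $V=[n]$: exactly one hyperedge $e^*\in E$ is defective (its vertices are the defective elements). A test is performed on a pool $T\subseteq[n]$ and returns a positive answer if and only if $T\cap e^*\neq\emptyset$. A non-adaptive algorithm chooses all of its pools in advance (so they can be tested in parallel) and then computes its output from the vector of test responses. The number of tests is the number of pools. -}

module Defs where

open import Data.Nat using (ℕ)
open import Data.Bool using (Bool; true; false; _∧_; _∨_)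
open import Data.Fin using (Fin)
open import Data.Fin.Subset using (Subset; ∣_∣; _─_)
open import Data.Vec using ([]; _∷_)
open import Data.Nat using (_<_)
open import Relation.Binary.PropositionalEquality using (_≡_)
open import Data.Product using (_×_)

testResult : ∀ {n} → Subset n → Subset n → Bool
testResult []       []       = false
testResult (x ∷ xs) (y ∷ ys) = (x ∧ y) ∨ testResult xs ys

-- A non-adaptive algorithm for a hypergraph with m hyperedges on [n]:
-- t pools fixed in advance, and a decoder computing, from the response
-- vector, which hyperedges are kept (true) / discarded (false).
record NonAdaptive (n m : ℕ) : Set where
  field
    tests  : ℕ
    pools  : Fin tests → Subset n
    decode : (Fin tests → Bool) → (Fin m → Bool)

open NonAdaptive public

responses : ∀ {n m} (A : NonAdaptive n m) → Subset n → Fin (tests A) → Bool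
responses A D j = testResult (pools A j) D

Succeeds : ∀ {n m} → (Fin m → Subset n) → ℕ → NonAdaptive n m → Set
Succeeds {n} {m} E p A =
  (k : Fin m) →
    (decode A (responses A (E k)) k ≡ true) ×
    ((i : Fin m) → decode A (responses A (E k)) i ≡ true → ∣ E i ─ E k ∣ < p)

{-# OPTIONS --safe #-}

-- Put each vertex into a pool independently with probability 1/(2d). If B = e* and C is a
-- hyperedge with |C ─ B| ≥ p, the pool misses the at most d vertices of B with probability
-- at least 1/2 and then meets C ─ B with probability at least p/(4d); so it separates the pair
-- (B, C) with probability at least p/(8d). By averaging, some pool separates a p/(8d) fraction
-- of any list of such pairs, and greedily choosing about 8d/p pools halves the list. At most
-- |E|² pairs need separating, so 2⌈log₂ |E|⌉ + 1 halving rounds separate all of them.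
-- The decoder keeps a hyperedge iff no negative test meets it.

module Submission where

open import Defs
open import Algebra.Bundles using (CommutativeMonoid)
open import Data.Bool using (Bool; true; false; _∧_; _∨_; not)
open import Data.Bool.Properties
  using (∧-distribˡ-∨; ∨-commutativeMonoid; ∨-inverseʳ; T-≡) renaming (_≟_ to _≟ᵇ_)
open import Data.Empty using (⊥; ⊥-elim)
open import Data.Fin using (Fin; zero; suc)
open import Data.Fin.Properties using (all?)
open import Data.Fin.Subset using (Subset; ∣_∣; _─_; _∪_)
open import Data.Fin.Subset.Properties using (∣p─q∣≤∣p∣)
open import Data.List
  using (List; []; _∷_; length; map; foldr; filter; filterᵇ; _++_; lookup; cartesianProduct; allFin)
open import Data.List.Properties using (length-++; length-map; length-filter; length-tabulate)
open import Data.List.Membership.Propositional using (_∈_)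
open import Data.List.Membership.Propositional.Properties using (∈-filter⁺; ∈-allFin; ∈-cartesianProduct⁺)
open import Data.List.Relation.Unary.All using (All; []; _∷_)
import Data.List.Relation.Unary.All as All
open import Data.List.Relation.Unary.All.Properties using (filter⁺; all-filter)
open import Data.List.Relation.Unary.Any using (Any; here; there; index)
open import Data.List.Relation.Unary.Any.Properties using (++⁺ˡ; ++⁺ʳ; lookup-index)
open import Data.Nat
open import Data.Nat.DivMod using (_/_; _%_; m≡m%n+[m/n]*n; m%n<n; m/n*n≤m)
open import Data.Nat.Induction using (<-rec)
open import Data.Nat.ListAction using (sum)
open import Data.Nat.Logarithm using (⌈log₂_⌉; ⌈log₂⌉-mono-≤; ⌈log₂⌈n/2⌉⌉≡⌈log₂n⌉∸1)
open import Data.Nat.Properties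
open import Data.Nat.Solver using (module +-*-Solver)
open import Data.Product using (Σ; ∃; _×_; _,_; proj₁; proj₂)
open import Data.Sum using (_⊎_; inj₁; inj₂)
open import Data.Vec using ([]; _∷_)
open import Function using (_∘_)
open import Function.Bundles using (Equivalence)
open import Function.Definitions using (Injective)
open import Relation.Binary.PropositionalEquality
open import Relation.Nullary using (Dec; yes; no; does)
open import Relation.Nullary.Decidable using (T?; dec-true)
open import Algebra.Properties.CommutativeSemigroup
  (CommutativeMonoid.commutativeSemigroup ∨-commutativeMonoid)
  using () renaming (interchange to ∨-interchange)

open +-*-Solver

n≤2^⌈log₂n⌉ : ∀ n → n ≤ 2 ^ ⌈log₂ n ⌉
n≤2^⌈log₂n⌉ = <-rec (λ n → n ≤ 2 ^ ⌈log₂ n ⌉) step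
  where
    step : ∀ n → (∀ {k} → k < n → k ≤ 2 ^ ⌈log₂ k ⌉) → n ≤ 2 ^ ⌈log₂ n ⌉
    step 0                 _  = z≤n
    step 1                 _  = m^n>0 2 ⌈log₂ 1 ⌉
    step n@(suc (suc n-2)) ih = begin
        n
      ≡⟨ sym (⌊n/2⌋+⌈n/2⌉≡n n) ⟩
        ⌊ n /2⌋ + ⌈ n /2⌉
      ≤⟨ +-monoˡ-≤ ⌈ n /2⌉ (⌊n/2⌋≤⌈n/2⌉ n) ⟩
        ⌈ n /2⌉ + ⌈ n /2⌉
      ≤⟨ +-mono-≤ half≤ half≤ ⟩
        2 ^ (L ∸ 1) + 2 ^ (L ∸ 1)
      ≡⟨ cong (2 ^ (L ∸ 1) +_) (sym (+-identityʳ (2 ^ (L ∸ 1)))) ⟩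
        2 ^ suc (L ∸ 1)
      ≡⟨ cong (2 ^_) (m+[n∸m]≡n (⌈log₂⌉-mono-≤ {2} {n} (s≤s (s≤s z≤n)))) ⟩
        2 ^ L
      ∎
      where
        open ≤-Reasoning
        L = ⌈log₂ n ⌉
        half≤ : ⌈ n /2⌉ ≤ 2 ^ (L ∸ 1)
        half≤ = subst (λ l → ⌈ n /2⌉ ≤ 2 ^ l) (⌈log₂⌈n/2⌉⌉≡⌈log₂n⌉∸1 n) (ih (⌈n/2⌉<n n-2))

length-cartesianProduct : ∀ {A B : Set} (xs : List A) (ys : List B) →
                          length (cartesianProduct xs ys) ≡ length xs * length ys
length-cartesianProduct []       ys = refl
length-cartesianProduct (x ∷ xs) ys = begin
    length (map (x ,_) ys ++ cartesianProduct xs ys)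
  ≡⟨ length-++ (map (x ,_) ys) ⟩
    length (map (x ,_) ys) + length (cartesianProduct xs ys)
  ≡⟨ cong₂ _+_ (length-map (x ,_) ys) (length-cartesianProduct xs ys) ⟩
    length ys + length xs * length ys
  ∎
  where open ≡-Reasoning

a≤[1+a/p]*p : ∀ a p .{{_ : NonZero p}} → a ≤ suc (a / p) * p
a≤[1+a/p]*p a p = begin
    a
  ≡⟨ m≡m%n+[m/n]*n a p ⟩
    a % p + a / p * p
  ≤⟨ +-monoˡ-≤ (a / p * p) (<⇒≤ (m%n<n a p)) ⟩
    p + a / p * p
  ∎
  where open ≤-Reasoning

[1+a/p]*p≤p+a : ∀ a p .{{_ : NonZero p}} → suc (a / p) * p ≤ p + a
[1+a/p]*p≤p+a a p = +-monoʳ-≤ p (m/n*n≤m a p)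

testResult-∪ : ∀ {n} (T B C : Subset n) →
               testResult T (B ∪ C) ≡ testResult T B ∨ testResult T C
testResult-∪ [] [] [] = refl
testResult-∪ (t ∷ T) (b ∷ B) (c ∷ C) = begin
    (t ∧ (b ∨ c)) ∨ testResult T (B ∪ C)
  ≡⟨ cong₂ _∨_ (∧-distribˡ-∨ t b c) (testResult-∪ T B C) ⟩
    ((t ∧ b) ∨ (t ∧ c)) ∨ (testResult T B ∨ testResult T C)
  ≡⟨ ∨-interchange (t ∧ b) (t ∧ c) (testResult T B) (testResult T C) ⟩
    ((t ∧ b) ∨ testResult T B) ∨ ((t ∧ c) ∨ testResult T C)
  ∎
  where open ≡-Reasoning

∣p∪q∣≡∣p∣+∣q─p∣ : ∀ {n} (p q : Subset n) → ∣ p ∪ q ∣ ≡ ∣ p ∣ + ∣ q ─ p ∣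
∣p∪q∣≡∣p∣+∣q─p∣ []          []          = refl
∣p∪q∣≡∣p∣+∣q─p∣ (true  ∷ p) (_     ∷ q) = cong suc (∣p∪q∣≡∣p∣+∣q─p∣ p q)
∣p∪q∣≡∣p∣+∣q─p∣ (false ∷ p) (true  ∷ q) =
  trans (cong suc (∣p∪q∣≡∣p∣+∣q─p∣ p q)) (sym (+-suc ∣ p ∣ ∣ q ─ p ∣))
∣p∪q∣≡∣p∣+∣q─p∣ (false ∷ p) (false ∷ q) = ∣p∪q∣≡∣p∣+∣q─p∣ p q

∣p─p∣≡0 : ∀ {n} (p : Subset n) → ∣ p ─ p ∣ ≡ 0
∣p─p∣≡0 []          = refl
∣p─p∣≡0 (true  ∷ p) = ∣p─p∣≡0 p
∣p─p∣≡0 (false ∷ p) = ∣p─p∣≡0 p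

𝟙 : Bool → ℕ
𝟙 true  = 1
𝟙 false = 0

count : ∀ {A : Set} → (A → Bool) → List A → ℕ
count f = sum ∘ map (𝟙 ∘ f)

avoids : ∀ {n} → Subset n → Subset n → Bool
avoids T X = not (testResult T X)

separates : ∀ {n} → Subset n → Subset n → Subset n → Bool
separates T B C = avoids T B ∧ testResult T C

𝟙-avoids-split : ∀ {n} (T B C : Subset n) →
                 𝟙 (avoids T B) ≡ 𝟙 (separates T B C) + 𝟙 (avoids T (B ∪ C))
𝟙-avoids-split T B C rewrite testResult-∪ T B C with testResult T B | testResult T C
... | true  | _     = refl
... | false | true  = refl
... | false | false = refl

-- A random pool contains each vertex independently with probability 1 / q, where q = 1 + r.
module RandomPool (r : ℕ) where

  q : ℕ
  q = suc r

  bernoulli : ∀ k → q ^ suc k ≤ q * r ^ k + k * q ^ k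
  bernoulli zero    = m≤m+n (q * 1) 0
  bernoulli (suc k) = begin
      q * (q * A)
    ≤⟨ *-monoʳ-≤ q (bernoulli k) ⟩
      q * (q * R + k * A)
    ≡⟨ solve 4 (λ r R k A → (con 1 :+ r) :* ((con 1 :+ r) :* R :+ k :* A)
                          := (con 1 :+ r) :* R :+ r :* ((con 1 :+ r) :* R) :+ k :* ((con 1 :+ r) :* A))
               refl r R k A ⟩
      q * R + r * (q * R) + k * (q * A)
    ≤⟨ +-monoˡ-≤ (k * (q * A)) (+-monoˡ-≤ (r * (q * R)) (*-monoʳ-≤ q (^-monoˡ-≤ k (n≤1+n r)))) ⟩
      q * A + r * (q * R) + k * (q * A)
    ≡⟨ solve 4 (λ r R k A → (con 1 :+ r) :* A :+ r :* ((con 1 :+ r) :* R) :+ k :* ((con 1 :+ r) :* A)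
                          := (con 1 :+ r) :* (r :* R) :+ (con 1 :+ k) :* ((con 1 :+ r) :* A))
               refl r R k A ⟩
      q * (r * R) + suc k * (q * A)
    ∎
    where
      open ≤-Reasoning
      A = q ^ k
      R = r ^ k

  binomial : ∀ k → r ^ suc k + suc k * r ^ k ≤ q ^ suc k
  binomial zero    = ≤-reflexive (solve 1 (λ r → r :* con 1 :+ con 1 :* con 1 := (con 1 :+ r) :* con 1) refl r)
  binomial (suc k) = begin
      r * (r * R) + suc (suc k) * (r * R)
    ≤⟨ m≤m+n _ (R + k * R) ⟩
      r * (r * R) + suc (suc k) * (r * R) + (R + k * R)
    ≡⟨ solve 3 (λ r R k → r :* (r :* R) :+ (con 2 :+ k) :* (r :* R) :+ (R :+ k :* R)
                        := (con 1 :+ r) :* (r :* R :+ (con 1 :+ k) :* R))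
               refl r R k ⟩
      q * (r * R + suc k * R)
    ≤⟨ *-monoʳ-≤ q (binomial k) ⟩
      q * q ^ suc k
    ∎
    where
      open ≤-Reasoning
      R = r ^ k

  miss-≥½ : ∀ b → 2 * b ≤ q → q ^ b ≤ 2 * r ^ b
  miss-≥½ b 2b≤q = *-cancelˡ-≤ q (+-cancelʳ-≤ (q * A) (q * A) (q * (2 * R)) (begin
      q * A + q * A
    ≡⟨ solve 1 (λ x → x :+ x := con 2 :* x) refl (q * A) ⟩
      2 * (q * A)
    ≤⟨ *-monoʳ-≤ 2 (bernoulli b) ⟩
      2 * (q * R + b * A)
    ≡⟨ solve 4 (λ q R b A → con 2 :* (q :* R :+ b :* A) := q :* (con 2 :* R) :+ con 2 :* b :* A) refl q R b A ⟩
      q * (2 * R) + 2 * b * A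
    ≤⟨ +-monoʳ-≤ (q * (2 * R)) (*-monoˡ-≤ A 2b≤q) ⟩
      q * (2 * R) + q * A
    ∎))
    where
      open ≤-Reasoning
      A = q ^ b
      R = r ^ b

  hit-≥ : ∀ a → 2 * a ≤ q → a * q ^ a + 2 * q * r ^ a ≤ 2 * q * q ^ a
  hit-≥ zero    _    = ≤-refl
  hit-≥ (suc a) 2a≤q = begin
      suc a * (q * A) + 2 * q * (r * R)
    ≤⟨ +-monoˡ-≤ (2 * q * (r * R)) (*-monoʳ-≤ (suc a) (*-monoʳ-≤ q (miss-≥½ a 2a′≤q))) ⟩
      suc a * (q * (2 * R)) + 2 * q * (r * R)
    ≡⟨ solve 4 (λ a q R r → (con 1 :+ a) :* (q :* (con 2 :* R)) :+ con 2 :* q :* (r :* R)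
                          := con 2 :* q :* (r :* R :+ (con 1 :+ a) :* R)) refl a q R r ⟩
      2 * q * (r * R + suc a * R)
    ≤⟨ *-monoʳ-≤ (2 * q) (binomial a) ⟩
      2 * q * (q * A)
    ∎
    where
      open ≤-Reasoning
      A = q ^ a
      R = r ^ a
      2a′≤q = ≤-trans (*-monoʳ-≤ 2 (n≤1+n a)) 2a≤q

  -- (r/q)^b (1 - (r/q)^a) ≥ a/(4q): missing b given vertices and meeting a further a ones.
  separation-≥ : ∀ a b → 2 * a ≤ q → 2 * b ≤ q →
                 a * q ^ b * q ^ a + 4 * q * r ^ b * r ^ a ≤ 4 * q * r ^ b * q ^ a
  separation-≥ a b 2a≤q 2b≤q = begin
      a * Qb * Qa + 4 * q * Rb * Ra
    ≤⟨ +-monoˡ-≤ (4 * q * Rb * Ra) (*-monoˡ-≤ Qa (*-monoʳ-≤ a (miss-≥½ b 2b≤q))) ⟩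
      a * (2 * Rb) * Qa + 4 * q * Rb * Ra
    ≡⟨ solve 5 (λ a Rb Qa q Ra → a :* (con 2 :* Rb) :* Qa :+ con 4 :* q :* Rb :* Ra
                               := con 2 :* Rb :* (a :* Qa :+ con 2 :* q :* Ra)) refl a Rb Qa q Ra ⟩
      2 * Rb * (a * Qa + 2 * q * Ra)
    ≤⟨ *-monoʳ-≤ (2 * Rb) (hit-≥ a 2a≤q) ⟩
      2 * Rb * (2 * q * Qa)
    ≡⟨ solve 3 (λ Rb q Qa → con 2 :* Rb :* (con 2 :* q :* Qa) := con 4 :* q :* Rb :* Qa) refl Rb q Qa ⟩
      4 * q * Rb * Qa
    ∎
    where
      open ≤-Reasoning
      Qa = q ^ a
      Qb = q ^ b
      Ra = r ^ a
      Rb = r ^ b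

  -- wsum f is q ^ n times the expected value of f at the random pool: in the sum over all
  -- pools, every vertex outside the pool contributes a factor r, every vertex inside a factor 1.
  wsum : ∀ {n} → (Subset n → ℕ) → ℕ
  wsum {zero}  f = f []
  wsum {suc n} f = wsum (f ∘ (true ∷_)) + r * wsum (f ∘ (false ∷_))

  wsum-cong : ∀ {n} {f g : Subset n → ℕ} → (∀ T → f T ≡ g T) → wsum f ≡ wsum g
  wsum-cong {zero}  f≗g = f≗g []
  wsum-cong {suc n} f≗g =
    cong₂ (λ x y → x + r * y) (wsum-cong (f≗g ∘ (true ∷_))) (wsum-cong (f≗g ∘ (false ∷_)))

  wsum-+ : ∀ {n} (f g : Subset n → ℕ) → wsum (λ T → f T + g T) ≡ wsum f + wsum g
  wsum-+ {zero}  f g = refl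
  wsum-+ {suc n} f g = begin
      wsum (λ T → f (true ∷ T) + g (true ∷ T)) + r * wsum (λ T → f (false ∷ T) + g (false ∷ T))
    ≡⟨ cong₂ (λ x y → x + r * y) (wsum-+ (f ∘ (true ∷_)) (g ∘ (true ∷_)))
                                 (wsum-+ (f ∘ (false ∷_)) (g ∘ (false ∷_))) ⟩
      (F₁ + G₁) + r * (F₀ + G₀)
    ≡⟨ solve 5 (λ F₁ G₁ r F₀ G₀ → (F₁ :+ G₁) :+ r :* (F₀ :+ G₀) := (F₁ :+ r :* F₀) :+ (G₁ :+ r :* G₀))
               refl F₁ G₁ r F₀ G₀ ⟩
      (F₁ + r * F₀) + (G₁ + r * G₀)
    ∎
    where
      open ≡-Reasoning
      F₁ = wsum (f ∘ (true ∷_))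
      F₀ = wsum (f ∘ (false ∷_))
      G₁ = wsum (g ∘ (true ∷_))
      G₀ = wsum (g ∘ (false ∷_))

  wsum-0 : ∀ {n} → wsum {n} (λ _ → 0) ≡ 0
  wsum-0 {zero}  = refl
  wsum-0 {suc n} rewrite wsum-0 {n} = *-zeroʳ r

  averaging : ∀ {n} a c (f : Subset n → ℕ) → c * q ^ n ≤ a * wsum f → ∃ λ T → c ≤ a * f T
  averaging {zero}  a c f c≤ = [] , subst (_≤ a * f []) (*-identityʳ c) c≤
  averaging {suc n} a c f c≤
    with c * q ^ n ≤? a * wsum (f ∘ (true ∷_)) | c * q ^ n ≤? a * wsum (f ∘ (false ∷_))
  ... | yes c≤₁ | _       = let T , c≤fT = averaging a c (f ∘ (true ∷_)) c≤₁ in true ∷ T , c≤fT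
  ... | no _    | yes c≤₀ = let T , c≤fT = averaging a c (f ∘ (false ∷_)) c≤₀ in false ∷ T , c≤fT
  ... | no c≰₁  | no c≰₀  = ⊥-elim (<⇒≱ too-small c≤)
    where
      open ≤-Reasoning
      F₁ = wsum (f ∘ (true ∷_))
      F₀ = wsum (f ∘ (false ∷_))
      Q = q ^ n
      too-small : a * (F₁ + r * F₀) < c * (q * Q)
      too-small = begin-strict
          a * (F₁ + r * F₀)
        ≡⟨ solve 4 (λ a F₁ r F₀ → a :* (F₁ :+ r :* F₀) := a :* F₁ :+ r :* (a :* F₀)) refl a F₁ r F₀ ⟩
          a * F₁ + r * (a * F₀)
        <⟨ +-mono-<-≤ (≰⇒> c≰₁) (*-monoʳ-≤ r (<⇒≤ (≰⇒> c≰₀))) ⟩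
          c * Q + r * (c * Q)
        ≡⟨ solve 3 (λ c Q r → c :* Q :+ r :* (c :* Q) := c :* ((con 1 :+ r) :* Q)) refl c Q r ⟩
          c * (q * Q)
        ∎

  wsum-avoids : ∀ {n} (X : Subset n) → wsum (λ T → 𝟙 (avoids T X)) * q ^ ∣ X ∣ ≡ r ^ ∣ X ∣ * q ^ n
  wsum-avoids []                = refl
  wsum-avoids {suc n} (true ∷ X) = begin
      (wsum {n} (λ _ → 0) + r * A) * (q * Q)
    ≡⟨ cong (λ z → (z + r * A) * (q * Q)) (wsum-0 {n}) ⟩
      r * A * (q * Q)
    ≡⟨ solve 4 (λ r A q Q → r :* A :* (q :* Q) := q :* r :* (A :* Q)) refl r A q Q ⟩
      q * r * (A * Q)
    ≡⟨ cong (q * r *_) (wsum-avoids X) ⟩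
      q * r * (r ^ ∣ X ∣ * q ^ n)
    ≡⟨ solve 4 (λ q r R Qn → q :* r :* (R :* Qn) := r :* R :* (q :* Qn)) refl q r (r ^ ∣ X ∣) (q ^ n) ⟩
      r * r ^ ∣ X ∣ * (q * q ^ n)
    ∎
    where
      open ≡-Reasoning
      A = wsum (λ T → 𝟙 (avoids T X))
      Q = q ^ ∣ X ∣
  wsum-avoids {suc n} (false ∷ X) = begin
      (A + r * A) * Q
    ≡⟨ solve 3 (λ r A Q → (A :+ r :* A) :* Q := (con 1 :+ r) :* (A :* Q)) refl r A Q ⟩
      q * (A * Q)
    ≡⟨ cong (q *_) (wsum-avoids X) ⟩
      q * (r ^ ∣ X ∣ * q ^ n)
    ≡⟨ solve 3 (λ q R Qn → q :* (R :* Qn) := R :* (q :* Qn)) refl q (r ^ ∣ X ∣) (q ^ n) ⟩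
      r ^ ∣ X ∣ * (q * q ^ n)
    ∎
    where
      open ≡-Reasoning
      A = wsum (λ T → 𝟙 (avoids T X))
      Q = q ^ ∣ X ∣

  wsum-avoids-∪ : ∀ {n} (B C : Subset n) →
                  wsum (λ T → 𝟙 (avoids T (B ∪ C))) * (q ^ ∣ B ∣ * q ^ ∣ C ─ B ∣)
                    ≡ r ^ ∣ B ∣ * r ^ ∣ C ─ B ∣ * q ^ n
  wsum-avoids-∪ {n} B C = begin
      A * (q ^ ∣ B ∣ * q ^ ∣ C ─ B ∣)
    ≡⟨ cong (λ k → A * k) (sym (^-distribˡ-+-* q ∣ B ∣ ∣ C ─ B ∣)) ⟩
      A * q ^ (∣ B ∣ + ∣ C ─ B ∣)
    ≡⟨ cong (λ k → A * q ^ k) (sym (∣p∪q∣≡∣p∣+∣q─p∣ B C)) ⟩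
      A * q ^ ∣ B ∪ C ∣
    ≡⟨ wsum-avoids (B ∪ C) ⟩
      r ^ ∣ B ∪ C ∣ * q ^ n
    ≡⟨ cong (λ k → r ^ k * q ^ n) (∣p∪q∣≡∣p∣+∣q─p∣ B C) ⟩
      r ^ (∣ B ∣ + ∣ C ─ B ∣) * q ^ n
    ≡⟨ cong (_* q ^ n) (^-distribˡ-+-* r ∣ B ∣ ∣ C ─ B ∣) ⟩
      r ^ ∣ B ∣ * r ^ ∣ C ─ B ∣ * q ^ n
    ∎
    where
      open ≡-Reasoning
      A = wsum (λ T → 𝟙 (avoids T (B ∪ C)))

  -- A pool avoiding B either separates B from C or avoids B ∪ C; multiplying through by
  -- q ^ ∣ B ∣ * q ^ ∣ C ─ B ∣ turns both avoidance weights into closed forms.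
  separation-weight : ∀ {n} (B C : Subset n) → 2 * ∣ B ∣ ≤ q → 2 * ∣ C ─ B ∣ ≤ q →
                      ∣ C ─ B ∣ * q ^ n ≤ 4 * q * wsum (λ T → 𝟙 (separates T B C))
  separation-weight {n} B C 2b≤q 2a≤q =
    *-cancelʳ-≤ (a * Qn) (4 * q * S) (Qb * Qa) {{m*n≢0 Qb Qa {{m^n≢0 q b}} {{m^n≢0 q a}}}}
      (+-cancelʳ-≤ Z (a * Qn * (Qb * Qa)) (4 * q * S * (Qb * Qa)) (begin
          a * Qn * (Qb * Qa) + Z
        ≡⟨ solve 7 (λ a Qn Qb Qa q Rb Ra → a :* Qn :* (Qb :* Qa) :+ con 4 :* q :* (Rb :* Ra :* Qn)
                                         := Qn :* (a :* Qb :* Qa :+ con 4 :* q :* Rb :* Ra))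
                   refl a Qn Qb Qa q Rb Ra ⟩
          Qn * (a * Qb * Qa + 4 * q * Rb * Ra)
        ≤⟨ *-monoʳ-≤ Qn (separation-≥ a b 2a≤q 2b≤q) ⟩
          Qn * (4 * q * Rb * Qa)
        ≡⟨ solve 4 (λ Qn q Rb Qa → Qn :* (con 4 :* q :* Rb :* Qa) := con 4 :* q :* (Rb :* Qn :* Qa))
                   refl Qn q Rb Qa ⟩
          4 * q * (Rb * Qn * Qa)
        ≡⟨ cong (λ k → 4 * q * (k * Qa)) (sym (wsum-avoids B)) ⟩
          4 * q * (wsum (λ T → 𝟙 (avoids T B)) * Qb * Qa)
        ≡⟨ cong (λ k → 4 * q * (k * Qb * Qa)) avoid-split ⟩
          4 * q * ((S + U) * Qb * Qa)
        ≡⟨ solve 5 (λ q S U Qb Qa → con 4 :* q :* ((S :+ U) :* Qb :* Qa)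
                                  := con 4 :* q :* S :* (Qb :* Qa) :+ con 4 :* q :* (U :* (Qb :* Qa)))
                   refl q S U Qb Qa ⟩
          4 * q * S * (Qb * Qa) + 4 * q * (U * (Qb * Qa))
        ≡⟨ cong (λ k → 4 * q * S * (Qb * Qa) + 4 * q * k) (wsum-avoids-∪ B C) ⟩
          4 * q * S * (Qb * Qa) + Z
        ∎))
    where
      open ≤-Reasoning
      a = ∣ C ─ B ∣
      b = ∣ B ∣
      Qn = q ^ n
      Qa = q ^ a
      Qb = q ^ b
      Ra = r ^ a
      Rb = r ^ b
      S = wsum (λ T → 𝟙 (separates T B C))
      U = wsum (λ T → 𝟙 (avoids T (B ∪ C)))
      Z = 4 * q * (Rb * Ra * Qn)
      avoid-split : wsum (λ T → 𝟙 (avoids T B)) ≡ S + U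
      avoid-split = trans (wsum-cong (λ T → 𝟙-avoids-split T B C))
                          (wsum-+ (λ T → 𝟙 (separates T B C)) (λ T → 𝟙 (avoids T (B ∪ C))))

  ∃-pool-covering : ∀ {n} {I : Set} c a (covers : Subset n → I → Bool) (W : List I) →
    All (λ x → c * q ^ n ≤ a * wsum (λ T → 𝟙 (covers T x))) W →
    ∃ λ T → c * length W ≤ a * count (covers T) W
  ∃-pool-covering {n} c a covers W each =
    averaging a (c * length W) (λ T → count (covers T) W) (total W each)
    where
      total : ∀ W → All (λ x → c * q ^ n ≤ a * wsum (λ T → 𝟙 (covers T x))) W →
              c * length W * q ^ n ≤ a * wsum (λ T → count (covers T) W)
      total [] [] = ≤-reflexive (begin-equality
          c * 0 * q ^ n
        ≡⟨ cong (_* q ^ n) (*-zeroʳ c) ⟩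
          0
        ≡⟨ sym (*-zeroʳ a) ⟩
          a * 0
        ≡⟨ cong (a *_) (sym (wsum-0 {n})) ⟩
          a * wsum {n} (λ _ → 0)
        ∎)
        where open ≤-Reasoning
      total (x ∷ W) (cx ∷ cW) = begin
          c * suc (length W) * q ^ n
        ≡⟨ solve 3 (λ c w Q → c :* (con 1 :+ w) :* Q := c :* Q :+ c :* w :* Q) refl c (length W) (q ^ n) ⟩
          c * q ^ n + c * length W * q ^ n
        ≤⟨ +-mono-≤ cx (total W cW) ⟩
          a * wsum (λ T → 𝟙 (covers T x)) + a * wsum (λ T → count (covers T) W)
        ≡⟨ sym (*-distribˡ-+ a _ _) ⟩
          a * (wsum (λ T → 𝟙 (covers T x)) + wsum (λ T → count (covers T) W))
        ≡⟨ cong (a *_) (sym (wsum-+ (λ T → 𝟙 (covers T x)) (λ T → count (covers T) W))) ⟩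
          a * wsum (λ T → count (covers T) (x ∷ W))
        ∎
        where open ≤-Reasoning

module GreedyCover {Pool Item : Set} (covers : Pool → Item → Bool) (Good : Item → Set)
  (c a : ℕ) .{{_ : NonZero a}}
  (good-pool : ∀ W → All Good W → ∃ λ T → c * length W ≤ a * count (covers T) W) where

  CoveredBy : List Pool → Item → Set
  CoveredBy Ts x = Any (λ T → covers T x ≡ true) Ts

  uncoveredBy : Pool → List Item → List Item
  uncoveredBy T = filterᵇ (not ∘ covers T)

  uncovered : List Pool → List Item → List Item
  uncovered Ts W = foldr uncoveredBy W Ts

  length-uncoveredBy : ∀ T W → length W ≡ count (covers T) W + length (uncoveredBy T W)
  length-uncoveredBy T []      = refl
  length-uncoveredBy T (x ∷ W) with covers T x
  ... | true  = cong suc (length-uncoveredBy T W)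
  ... | false = trans (cong suc (length-uncoveredBy T W)) (sym (+-suc _ _))

  uncovered⁺ : ∀ Ts {W} → All Good W → All Good (uncovered Ts W)
  uncovered⁺ []       good = good
  uncovered⁺ (T ∷ Ts) good = filter⁺ (T? ∘ not ∘ covers T) (uncovered⁺ Ts good)

  covered-or-uncovered : ∀ Ts {W x} → x ∈ W → CoveredBy Ts x ⊎ x ∈ uncovered Ts W
  covered-or-uncovered []            x∈W = inj₂ x∈W
  covered-or-uncovered (T ∷ Ts) {x = x} x∈W with covered-or-uncovered Ts x∈W
  ... | inj₁ covered = inj₁ (there covered)
  ... | inj₂ x∈U with covers T x in eq
  ...   | true  = inj₁ (here eq)
  ...   | false = inj₂ (∈-filter⁺ (T? ∘ not ∘ covers T) x∈U (Equivalence.from T-≡ (cong not eq)))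

  -- Each of the j greedy choices removed at least c w / a items, w being the number left at the end.
  greedy-steps : ∀ j W → All Good W → ∃ λ Ts → length Ts ≡ j ×
    j * (c * length (uncovered Ts W)) + a * length (uncovered Ts W) ≤ a * length W
  greedy-steps zero    W good = [] , refl , ≤-refl
  greedy-steps (suc j) W good with greedy-steps j W good
  ... | Ts , refl , inv with good-pool (uncovered Ts W) (uncovered⁺ Ts good)
  ...   | T , cw≤a·covered = T ∷ Ts , refl , (begin
      suc j * (c * w′) + a * w′
    ≡⟨ solve 4 (λ j x a w′ → (con 1 :+ j) :* x :+ a :* w′ := x :+ j :* x :+ a :* w′)
               refl j (c * w′) a w′ ⟩
      c * w′ + j * (c * w′) + a * w′
    ≤⟨ +-monoˡ-≤ (a * w′) (+-mono-≤ (≤-trans (*-monoʳ-≤ c w′≤w) cw≤a·covered)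
                                    (*-monoʳ-≤ j (*-monoʳ-≤ c w′≤w))) ⟩
      a * covered + j * (c * w) + a * w′
    ≡⟨ solve 4 (λ a k y w′ → a :* k :+ y :+ a :* w′ := y :+ a :* (k :+ w′))
               refl a covered (j * (c * w)) w′ ⟩
      j * (c * w) + a * (covered + w′)
    ≡⟨ cong (λ k → j * (c * w) + a * k) (sym split) ⟩
      j * (c * w) + a * w
    ≤⟨ inv ⟩
      a * length W
    ∎)
    where
      open ≤-Reasoning
      U = uncovered Ts W
      w = length U
      w′ = length (uncoveredBy T U)
      covered = count (covers T) U
      split : w ≡ covered + w′
      split = length-uncoveredBy T U
      w′≤w : w′ ≤ w
      w′≤w = subst (w′ ≤_) (sym split) (m≤n+m w′ covered)

  halving : ∀ K → a ≤ K * c → ∀ W → All Good W →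
            ∃ λ Ts → length Ts ≡ K × 2 * length (uncovered Ts W) ≤ length W
  halving K a≤Kc W good with greedy-steps K W good
  ... | Ts , len , inv = Ts , len , *-cancelˡ-≤ a (begin
      a * (2 * w)
    ≡⟨ solve 2 (λ a w → a :* (con 2 :* w) := a :* w :+ a :* w) refl a w ⟩
      a * w + a * w
    ≤⟨ +-monoˡ-≤ (a * w) (≤-trans (*-monoˡ-≤ w a≤Kc) (≤-reflexive (*-assoc K c w))) ⟩
      K * (c * w) + a * w
    ≤⟨ inv ⟩
      a * length W
    ∎)
    where
      open ≤-Reasoning
      w = length (uncovered Ts W)

  greedy-cover : ∀ K → a ≤ K * c → ∀ s W → All Good W → length W < 2 ^ s →
                 ∃ λ Ts → length Ts ≡ s * K × All (CoveredBy Ts) W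
  greedy-cover K a≤Kc zero    []      good _           = [] , refl , []
  greedy-cover K a≤Kc zero    (_ ∷ _) good (s≤s ())
  greedy-cover K a≤Kc (suc s) W       good W<2^[1+s]
    with halving K a≤Kc W good
  ... | Ts₂ , len₂ , halved
    with greedy-cover K a≤Kc s (uncovered Ts₂ W) (uncovered⁺ Ts₂ good)
           (*-cancelˡ-< 2 _ _ (≤-<-trans halved W<2^[1+s]))
  ...   | Ts₁ , len₁ , cover₁ =
    Ts₁ ++ Ts₂ ,
    trans (length-++ Ts₁) (trans (cong₂ _+_ len₁ len₂) (+-comm (s * K) K)) ,
    All.tabulate covered
    where
      covered : ∀ {x} → x ∈ W → CoveredBy (Ts₁ ++ Ts₂) x
      covered x∈W with covered-or-uncovered Ts₂ x∈W
      ... | inj₁ by₂ = ++⁺ʳ Ts₁ by₂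
      ... | inj₂ x∈U = ++⁺ˡ (All.lookup cover₁ x∈U)

negativeDecoding : ∀ {n m} → (Fin m → Subset n) → List (Subset n) → NonAdaptive n m
negativeDecoding E Ts = record
  { tests  = length Ts
  ; pools  = lookup Ts
  ; decode = λ res i → does (all? λ j → res j ∨ not (testResult (lookup Ts j) (E i)) ≟ᵇ true)
  }

negativeDecoding-succeeds : ∀ {n m} (E : Fin m → Subset n) p Ts →
  (∀ k i → p ≤ ∣ E i ─ E k ∣ → Any (λ T → separates T (E k) (E i) ≡ true) Ts) →
  Succeeds E p (negativeDecoding E Ts)
negativeDecoding-succeeds E p Ts separated k = kept-defective , discarded
  where
    A = negativeDecoding E Ts
    hit : Fin (length Ts) → Subset _ → Bool
    hit j = testResult (lookup Ts j)

    kept-defective : decode A (responses A (E k)) k ≡ true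
    kept-defective =
      dec-true (all? λ j → hit j (E k) ∨ not (hit j (E k)) ≟ᵇ true) (λ j → ∨-inverseʳ (hit j (E k)))

    inconsistent : ∀ x y → not x ∧ y ≡ true → x ∨ not y ≡ true → ⊥
    inconsistent false true _ ()

    does-true : ∀ {P : Set} (P? : Dec P) → does P? ≡ true → P
    does-true (yes p) _ = p

    consistent : ∀ i → decode A (responses A (E k)) i ≡ true →
                 ∀ j → hit j (E k) ∨ not (hit j (E i)) ≡ true
    consistent i = does-true (all? λ j → hit j (E k) ∨ not (hit j (E i)) ≟ᵇ true)

    discarded : ∀ i → decode A (responses A (E k)) i ≡ true → ∣ E i ─ E k ∣ < p
    discarded i kept with p ≤? ∣ E i ─ E k ∣
    ... | no  p≰ = ≰⇒> p≰
    ... | yes p≤ =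
      ⊥-elim (inconsistent (hit j (E k)) (hit j (E i)) (lookup-index sep) (consistent i kept j))
      where
        sep = separated k i p≤
        j = index sep

module Separating {n m} (E : Fin m → Subset n) {r d : ℕ} (q≡2d : suc r ≡ 2 * d)
  (∣E∣≤d : ∀ i → ∣ E i ∣ ≤ d) (p : ℕ) .{{_ : NonZero p}} where
  open RandomPool r

  Pair : Set
  Pair = Fin m × Fin m

  MustDiscard : Pair → Set
  MustDiscard (k , i) = p ≤ ∣ E i ─ E k ∣

  separatesPair : Subset n → Pair → Bool
  separatesPair T (k , i) = separates T (E k) (E i)

  2∣E∣≤q : ∀ i → 2 * ∣ E i ∣ ≤ q
  2∣E∣≤q i = subst (2 * ∣ E i ∣ ≤_) (sym q≡2d) (*-monoʳ-≤ 2 (∣E∣≤d i))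

  good-pool : ∀ W → All MustDiscard W → ∃ λ T → p * length W ≤ 4 * q * count (separatesPair T) W
  good-pool W must = ∃-pool-covering p (4 * q) separatesPair W (All.map separation-likely must)
    where
      separation-likely : ∀ {x} → MustDiscard x →
                          p * q ^ n ≤ 4 * q * wsum (λ T → 𝟙 (separatesPair T x))
      separation-likely {k , i} p≤ = ≤-trans (*-monoˡ-≤ (q ^ n) p≤)
        (separation-weight (E k) (E i) (2∣E∣≤q k)
          (≤-trans (*-monoʳ-≤ 2 (∣p─q∣≤∣p∣ (E i) (E k))) (2∣E∣≤q i)))

  open GreedyCover separatesPair MustDiscard p (4 * q) good-pool

  mustDiscard? : (x : Pair) → Dec (MustDiscard x)
  mustDiscard? (k , i) = p ≤? ∣ E i ─ E k ∣

  allPairs : List Pair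
  allPairs = cartesianProduct (allFin m) (allFin m)

  badPairs : List Pair
  badPairs = filter mustDiscard? allPairs

  length-badPairs : ∀ L → m ≤ 2 ^ L → length badPairs < 2 ^ suc (L + L)
  length-badPairs L m≤2^L = begin-strict
      length badPairs
    ≤⟨ length-filter mustDiscard? allPairs ⟩
      length allPairs
    ≡⟨ trans (length-cartesianProduct (allFin m) (allFin m))
             (cong₂ _*_ (length-tabulate {n = m} (λ x → x)) (length-tabulate {n = m} (λ x → x))) ⟩
      m * m
    ≤⟨ *-mono-≤ m≤2^L m≤2^L ⟩
      2 ^ L * 2 ^ L
    ≡⟨ sym (^-distribˡ-+-* 2 L L) ⟩
      2 ^ (L + L)
    <⟨ ^-monoʳ-< 2 (s≤s (s≤s z≤n)) (n<1+n (L + L)) ⟩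
      2 ^ suc (L + L)
    ∎
    where open ≤-Reasoning

  algorithm : ∀ L → 1 ≤ L → m ≤ 2 ^ L → p ≤ d →
    Σ (NonAdaptive n m) λ A → Succeeds E p A × p * tests A ≤ 27 * d * L
  algorithm L 1≤L m≤2^L p≤d =
    negativeDecoding E Ts , negativeDecoding-succeeds E p Ts separated , bound
    where
      s = suc (L + L)
      K = suc (4 * q / p)

      cover : ∃ λ Ts → length Ts ≡ s * K × All (CoveredBy Ts) badPairs
      cover = greedy-cover K (a≤[1+a/p]*p (4 * q) p) s badPairs
                (all-filter mustDiscard? allPairs) (length-badPairs L m≤2^L)

      Ts = proj₁ cover

      separated : ∀ k i → p ≤ ∣ E i ─ E k ∣ → CoveredBy Ts (k , i)
      separated k i p≤ = All.lookup (proj₂ (proj₂ cover))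
        (∈-filter⁺ mustDiscard? (∈-cartesianProduct⁺ (∈-allFin k) (∈-allFin i)) p≤)

      bound : p * length Ts ≤ 27 * d * L
      bound = begin
          p * length Ts
        ≡⟨ cong (p *_) (proj₁ (proj₂ cover)) ⟩
          p * (s * K)
        ≡⟨ solve 3 (λ p s K → p :* (s :* K) := s :* (K :* p)) refl p s K ⟩
          s * (K * p)
        ≤⟨ *-monoʳ-≤ s ([1+a/p]*p≤p+a (4 * q) p) ⟩
          s * (p + 4 * q)
        ≤⟨ *-monoʳ-≤ s (+-mono-≤ p≤d (≤-reflexive (cong (4 *_) q≡2d))) ⟩
          s * (d + 4 * (2 * d))
        ≤⟨ *-monoˡ-≤ (d + 4 * (2 * d)) (+-monoˡ-≤ (L + L) 1≤L) ⟩
          (L + (L + L)) * (d + 4 * (2 * d))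
        ≡⟨ solve 2 (λ L d → (L :+ (L :+ L)) :* (d :+ con 4 :* (con 2 :* d)) := con 27 :* d :* L) refl L d ⟩
          27 * d * L
        ∎
        where open ≤-Reasoning

acceptAll : ∀ {n m} → NonAdaptive n m
acceptAll = record { tests = 0 ; pools = λ () ; decode = λ _ _ → true }

acceptAll-succeeds : ∀ {n p} (E : Fin 1 → Subset n) → 1 ≤ p → Succeeds E p acceptAll
acceptAll-succeeds {p = p} E 1≤p zero = refl , λ { zero _ → subst (_< p) (sym (∣p─p∣≡0 (E zero))) 1≤p }

theorem2 : ∃ λ (C : ℕ) →
    (n d p m : ℕ) → (E : Fin m → Subset n) → Injective _≡_ _≡_ E →
    ((i : Fin m) → ∣ E i ∣ ≤ d) →
    1 ≤ p → suc p ≤ d →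
    Σ (NonAdaptive n m) λ A →
      Succeeds E p A × (p * tests A ≤ C * d * ⌈log₂ m ⌉)
theorem2 = 27 , algorithm
  where
    no-tests : ∀ p C → p * 0 ≤ C
    no-tests p C = subst (_≤ C) (sym (*-zeroʳ p)) z≤n

    algorithm : (n d p m : ℕ) → (E : Fin m → Subset n) → Injective _≡_ _≡_ E →
      ((i : Fin m) → ∣ E i ∣ ≤ d) → 1 ≤ p → suc p ≤ d →
      Σ (NonAdaptive n m) λ A → Succeeds E p A × (p * tests A ≤ 27 * d * ⌈log₂ m ⌉)
    algorithm n d       p 0 E _ _ _   _ = acceptAll , (λ ()) , no-tests p _
    algorithm n d       p 1 E _ _ 1≤p _ = acceptAll , acceptAll-succeeds E 1≤p , no-tests p _
    algorithm n 0       p (suc (suc _)) E _ _ _ ()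
    algorithm n d@(suc _) p m@(suc (suc _)) E _ ∣E∣≤d 1≤p p<d =
      Separating.algorithm E (suc-pred (2 * d)) ∣E∣≤d p {{>-nonZero 1≤p}}
        ⌈log₂ m ⌉ (⌈log₂⌉-mono-≤ {2} {m} (s≤s (s≤s z≤n))) (n≤2^⌈log₂n⌉ m) (<⇒≤ p<d)
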